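{- Each diagonal of a special rim hook tableau contains at most one initial cell.
   Context: For a partition $\lambda=(\lambda_1\ge\dots\ge\lambda_\ell>0)$, its Ferrers diagram is the set of cells $(i,j)$ with $1\le i\le\ell$, $1\le j\le\lambda_i$ (row $i$ from the top, column $j$ from the left). A rim hook is a connected skew diagram (set difference of two Ferrers diagrams of partitions) containing no $2\times2$ square of cells. A special rim hook tableau of shape $\lambda$ is a partition of the cells of the diagram of $\lambda$ into rim hooks such that each rim hook contains a cell of the first column. The initial cell of a rim hook is its northeastern-most cell, and its terminal cell is its southwestern-most cell. The $d$-th diagonal is $\mathcal L_d=\{(d+k,1+k): k\in\mathbb Z\}$, so $(x,y)\in\mathcal L_d$ iff $d=x-y+1$; "the diagonal contains an initial cell" refers to initial cells of the rim hooks of the tableau. -}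

module Defs where

open import Data.Nat using (ℕ; zero; suc; _≤_; _<_; _≥_)
open import Data.Integer as ℤ using (ℤ; +_)
open import Data.List using (List; []; _∷_; length)
open import Data.List.Relation.Unary.All using (All)
open import Data.List.Relation.Unary.Linked using (Linked)
open import Data.List.Membership.Propositional using (_∈_)
open import Data.Fin using (Fin)
open import Data.List using (lookup)
open import Data.Product using (Σ; ∃; _×_; _,_; proj₁; proj₂)
open import Data.Sum using (_⊎_)
open import Relation.Nullary using (¬_)
open import Relation.Binary.PropositionalEquality using (_≡_)

-- A cell (i , j): row i (from the top), column j (from the left), 1-indexed.
Cell : Set
Cell = ℕ × ℕ

row col : Cell → ℕ
row = proj₁
col = proj₂

IsPartition : List ℕ → Set
IsPartition λs = Linked _≥_ λs × All (0 <_) λs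

-- λ_i for 1-indexed i (0 outside 1..ℓ).
part : List ℕ → ℕ → ℕ
part []       _             = 0
part (a ∷ l)  zero          = 0
part (a ∷ l)  (suc zero)    = a
part (a ∷ l)  (suc (suc i)) = part l (suc i)

InDiagram : List ℕ → Cell → Set
InDiagram λs (i , j) = 1 ≤ i × i ≤ length λs × 1 ≤ j × j ≤ part λs i

Adjacent : Cell → Cell → Set
Adjacent (a , b) (c , d) =
  (a ≡ c × (suc b ≡ d ⊎ suc d ≡ b)) ⊎ (b ≡ d × (suc a ≡ c ⊎ suc c ≡ a))

data Walk (S : List Cell) : Cell → Cell → Set where
  here : ∀ {c} → Walk S c c
  step : ∀ {c c' c''} → c' ∈ S → Adjacent c c' → Walk S c' c'' → Walk S c c''

IsConnected : List Cell → Set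
IsConnected S = ∀ {c c'} → c ∈ S → c' ∈ S → Walk S c c'

IsSkewDiagram : List Cell → Set
IsSkewDiagram S = Σ (List ℕ) λ μ → Σ (List ℕ) λ ν →
  IsPartition μ × IsPartition ν ×
  (∀ c → (c ∈ S → InDiagram μ c × ¬ InDiagram ν c)
       × (InDiagram μ c → ¬ InDiagram ν c → c ∈ S))

No2x2 : List Cell → Set
No2x2 S = ∀ i j → ¬ ((i , j) ∈ S × (suc i , j) ∈ S × (i , suc j) ∈ S × (suc i , suc j) ∈ S)

IsRimHook : List Cell → Set
IsRimHook S = (∃ λ c → c ∈ S) × IsSkewDiagram S × IsConnected S × No2x2 S

record SpecialRimHookTableau (λs : List ℕ) : Set where
  field
    hooks    : List (List Cell)
    rimHook  : All IsRimHook hooks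
    special  : All (λ S → ∃ λ c → c ∈ S × col c ≡ 1) hooks
    inShape  : All (λ S → ∀ c → c ∈ S → InDiagram λs c) hooks
    covers   : ∀ c → InDiagram λs c → ∃ λ k → c ∈ lookup hooks k
    disjoint : ∀ (k k' : Fin (length hooks)) c →
               c ∈ lookup hooks k → c ∈ lookup hooks k' → k ≡ k'

IsInitialCell : List Cell → Cell → Set
IsInitialCell S c = c ∈ S × (∀ c' → c' ∈ S → row c ≤ row c' × col c' ≤ col c)

IsInitialCellOf : ∀ {λs} → SpecialRimHookTableau λs → Cell → Set
IsInitialCellOf T c = ∃ λ k → IsInitialCell (lookup (SpecialRimHookTableau.hooks T) k) c

diagonal : Cell → ℤ
diagonal (x , y) = (+ x ℤ.- + y) ℤ.+ + 1

{-# OPTIONS --safe #-}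
-- A skew shape is convex for the componentwise order on cells, so if a cell (i , j+1) of a
-- connected skew shape has neither its west nor its south neighbour, no step inside the shape
-- leaves the quadrant north-east of that cell.  Hence a rim hook meeting the first column
-- contains, together with any cell (i , j+1) with j ≥ 1, its west or its south neighbour.
-- Now let A = (x , a) and B = (x+n+1 , a+n+1) be initial cells on one diagonal, and follow
-- the cells just east of the diagonal cells from A to B.  The hook of the cell east of A
-- cannot contain A, the initial cell of another hook; the hook of each later east cell cannot
-- contain the diagonal cell west of it, as that cell shares a hook with the previous east
-- cell, which is diagonally adjacent to it.  So every one of these hooks turns south, and
-- the last one contains both B and the cell north of B, which B being initial forbids.
module Submission where

open import Defs
open import Data.Nat using (ℕ; zero; suc; _+_; _≤_; _≥_; z≤n; s≤s; _≟_; _≤?_)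
open import Data.Nat.Properties
open import Data.Integer as ℤ using (ℤ; +_; 1ℤ)
import Data.Integer.Properties as ℤ
open import Data.Integer.Tactic.RingSolver using (solve-∀)
open import Data.List using (List; []; _∷_; length; lookup)
open import Data.List.Relation.Unary.All as All using ()
open import Data.List.Relation.Unary.Linked using (Linked; _∷_; tail)
open import Data.List.Membership.Propositional using (_∈_; _∉_)
open import Data.List.Membership.Propositional.Properties using (∈-lookup)
open import Data.Product.Properties using (≡-dec)
open import Data.List.Membership.DecPropositional (≡-dec _≟_ _≟_) using (_∈?_)
open import Data.List.Relation.Binary.Subset.Propositional using (_⊆_)
open import Data.List.Relation.Binary.Subset.Propositional.Properties using (⊆-reflexive)
open import Data.Fin using (Fin)
open import Data.Product using (∃; ∃-syntax; _×_; _,_; proj₁; proj₂)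
open import Data.Sum using (_⊎_; inj₁; inj₂; [_,_]′)
open import Data.Empty using (⊥-elim)
open import Relation.Nullary using (¬_; yes; no)
open import Relation.Binary.PropositionalEquality
  using (_≡_; refl; sym; trans; cong; cong₂; module ≡-Reasoning)

part≤head : ∀ {a l} → Linked _≥_ (a ∷ l) → ∀ i → part (a ∷ l) i ≤ a
part≤head              _              zero          = z≤n
part≤head              _              (suc zero)    = ≤-refl
part≤head {l = []}     _              (suc (suc i)) = z≤n
part≤head {l = _ ∷ _}  (a≥b ∷ sorted) (suc (suc i)) = ≤-trans (part≤head sorted (suc i)) a≥b

part-antitone : ∀ {μ i j} → Linked _≥_ μ → 1 ≤ i → i ≤ j → part μ j ≤ part μ i
part-antitone {[]}                                _      _ _         = z≤n
part-antitone {_ ∷ _} {suc zero}    {j}           sorted _ _         = part≤head sorted j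
part-antitone {_ ∷ _} {suc (suc i)} {suc (suc j)} sorted _ (s≤s i≤j) =
  part-antitone (tail sorted) (s≤s z≤n) i≤j

_≼_ : Cell → Cell → Set
c ≼ c' = row c ≤ row c' × col c ≤ col c'

≼-trans : ∀ {a b c} → a ≼ b → b ≼ c → a ≼ c
≼-trans (r , k) (r' , k') = ≤-trans r r' , ≤-trans k k'

InDiagram⇒positive : ∀ {μ c} → InDiagram μ c → (1 , 1) ≼ c
InDiagram⇒positive (1≤i , _ , 1≤j , _) = 1≤i , 1≤j

InDiagram-downClosed : ∀ {μ c c'} → IsPartition μ → (1 , 1) ≼ c → c ≼ c' →
                       InDiagram μ c' → InDiagram μ c
InDiagram-downClosed (sorted , _) (1≤i , 1≤j) (i≤i' , j≤j') (_ , i'≤ℓ , _ , j'≤part) =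
  1≤i , ≤-trans i≤i' i'≤ℓ , 1≤j , ≤-trans j≤j' (≤-trans j'≤part (part-antitone sorted 1≤i i≤i'))

skew-convex : ∀ {S a b c} → IsSkewDiagram S → a ∈ S → b ∈ S → a ≼ c → c ≼ b → c ∈ S
skew-convex {a = a} {b} {c} (μ , ν , pμ , pν , S≡μ∖ν) a∈S b∈S a≼c c≼b = proj₂ (S≡μ∖ν c) c∈μ c∉ν
  where
  a-positive : (1 , 1) ≼ a
  a-positive = InDiagram⇒positive {μ} (proj₁ (proj₁ (S≡μ∖ν a) a∈S))
  c∈μ : InDiagram μ c
  c∈μ = InDiagram-downClosed pμ (≼-trans a-positive a≼c) c≼b (proj₁ (proj₁ (S≡μ∖ν b) b∈S))
  c∉ν : ¬ InDiagram ν c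
  c∉ν c∈ν = proj₂ (proj₁ (S≡μ∖ν a) a∈S) (InDiagram-downClosed pν a-positive a≼c c∈ν)

rimHook-noDiagonalPair : ∀ {S i j} → IsRimHook S → (i , j) ∈ S → (suc i , suc j) ∉ S
rimHook-noDiagonalPair {S} {i} {j} (_ , skew , _ , no2×2) ij∈S ij'∈S =
  no2×2 i j ( ij∈S
            , between (n≤1+n i , ≤-refl) (≤-refl , n≤1+n j)
            , between (≤-refl , n≤1+n j) (n≤1+n i , ≤-refl)
            , ij'∈S)
  where
  between : ∀ {c} → (i , j) ≼ c → c ≼ (suc i , suc j) → c ∈ S
  between = skew-convex skew ij∈S ij'∈S

walk-preserves : ∀ {S} (P : Cell → Set) →
                 (∀ {c c'} → P c → c' ∈ S → Adjacent c c' → P c') →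
                 ∀ {c c'} → Walk S c c' → P c → P c'
walk-preserves P step-preserves here              p = p
walk-preserves P step-preserves (step c'∈S adj w) p =
  walk-preserves P step-preserves w (step-preserves p c'∈S adj)

module _ {S i j} (skew : IsSkewDiagram S) (corner∈S : (i , suc j) ∈ S)
         (no-south : (suc i , suc j) ∉ S) (no-west : (i , j) ∉ S) where

  NorthEastOfCorner : Cell → Set
  NorthEastOfCorner c = row c ≤ i × suc j ≤ col c

  northEast-step : ∀ {c c'} → NorthEastOfCorner c → c' ∈ S → Adjacent c c' →
                   NorthEastOfCorner c'
  northEast-step (r , k) _ (inj₁ (refl , inj₁ refl)) = r , ≤-trans k (n≤1+n _)
  northEast-step (r , k) _ (inj₂ (refl , inj₂ refl)) = ≤-trans (n≤1+n _) r , k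
  northEast-step {_ , _} {_ , d} (r , k) c'∈S (inj₁ (refl , inj₂ refl)) with suc j ≤? d
  ... | yes j<d = r , j<d
  ... | no  j≮d = ⊥-elim (no-west (skew-convex skew c'∈S corner∈S
                                     (r , ≤-pred (≰⇒> j≮d)) (≤-refl , n≤1+n j)))
  northEast-step {a , _} {_ , _} (r , k) c'∈S (inj₂ (refl , inj₁ refl)) with suc a ≤? i
  ... | yes a<i = a<i , k
  ... | no  a≮i = ⊥-elim (no-south (skew-convex skew corner∈S c'∈S
                                      (n≤1+n i , ≤-refl) (≰⇒> a≮i , k)))

  connectedSkew-northEastOfCorner : IsConnected S → ∀ {c} → c ∈ S → NorthEastOfCorner c
  connectedSkew-northEastOfCorner connected c∈S =
    walk-preserves NorthEastOfCorner northEast-step (connected corner∈S c∈S) (≤-refl , ≤-refl)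

specialRimHook-continues : ∀ {S i j} → IsRimHook S → (∃ λ c → c ∈ S × col c ≡ 1) →
                           (i , suc j) ∈ S → 1 ≤ j → (suc i , suc j) ∈ S ⊎ (i , j) ∈ S
specialRimHook-continues {S} {i} {j} (_ , skew , connected , _) (c , c∈S , c-in-column1)
                         corner∈S 1≤j
  with (suc i , suc j) ∈? S | (i , j) ∈? S
... | yes south    | _          = inj₁ south
... | no  _        | yes west   = inj₂ west
... | no  no-south | no no-west =
  ⊥-elim (<-irrefl (sym c-in-column1) (≤-trans (s≤s 1≤j) (proj₂ c-northEast)))
  where
  c-northEast : NorthEastOfCorner skew corner∈S no-south no-west c
  c-northEast = connectedSkew-northEastOfCorner skew corner∈S no-south no-west connected c∈S

IsInitialCell-noEast : ∀ {S i j} → IsInitialCell S (i , j) → (i , suc j) ∉ S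
IsInitialCell-noEast (_ , extremal) east = <-irrefl refl (proj₂ (extremal _ east))

IsInitialCell-noNorth : ∀ {S i j} → IsInitialCell S (suc i , j) → (i , j) ∉ S
IsInitialCell-noNorth (_ , extremal) north = <-irrefl refl (proj₁ (extremal _ north))

_↘_ : Cell → ℕ → Cell
c ↘ n = (n + row c , n + col c)

diagonal-≡⇒+-≡ : ∀ {c c'} → diagonal c ≡ diagonal c' → row c + col c' ≡ row c' + col c
diagonal-≡⇒+-≡ {x , y} {x' , y'} eq = ℤ.+-injective (begin
  + (x + y')                                    ≡⟨ ℤ.pos-+ x y' ⟩
  + x ℤ.+ + y'                                  ≡⟨ undo (+ x) (+ y) (+ y') ⟩
  diagonal (x , y) ℤ.+ (+ y ℤ.+ + y') ℤ.- 1ℤ    ≡⟨ cong (λ d → d ℤ.+ (+ y ℤ.+ + y') ℤ.- 1ℤ) eq ⟩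
  diagonal (x' , y') ℤ.+ (+ y ℤ.+ + y') ℤ.- 1ℤ  ≡⟨ cong (λ s → diagonal (x' , y') ℤ.+ s ℤ.- 1ℤ)
                                                        (ℤ.+-comm (+ y) (+ y')) ⟩
  diagonal (x' , y') ℤ.+ (+ y' ℤ.+ + y) ℤ.- 1ℤ  ≡⟨ undo (+ x') (+ y') (+ y) ⟨
  + x' ℤ.+ + y                                  ≡⟨ ℤ.pos-+ x' y ⟨
  + (x' + y)                                    ∎)
  where
  open ≡-Reasoning
  undo : ∀ p q s → p ℤ.+ s ≡ ((p ℤ.- q) ℤ.+ 1ℤ) ℤ.+ (q ℤ.+ s) ℤ.- 1ℤ
  undo = solve-∀

sameDiagonal-≤⇒↘ : ∀ {c c'} → diagonal c ≡ diagonal c' → row c ≤ row c' → ∃[ n ] c' ≡ c ↘ n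
sameDiagonal-≤⇒↘ {x , y} {x' , y'} eq x≤x' with m≤n⇒∃[o]m+o≡n x≤x'
... | n , refl = n , cong₂ _,_ (+-comm x n) (+-cancelˡ-≡ x _ _ (trans x+y'≡x+n+y (+-assoc x n y)))
  where
  x+y'≡x+n+y : x + y' ≡ x + n + y
  x+y'≡x+n+y = diagonal-≡⇒+-≡ {x , y} {x + n , y'} eq

module _ {λs : List ℕ} (pλ : IsPartition λs) (T : SpecialRimHookTableau λs) where
  open SpecialRimHookTableau T

  private
    hook : Fin (length hooks) → List Cell
    hook = lookup hooks

    hook-isRimHook : ∀ k → IsRimHook (hook k)
    hook-isRimHook k = All.lookup rimHook (∈-lookup k)

    hook⊆shape : ∀ k {c} → c ∈ hook k → InDiagram λs c
    hook⊆shape k = All.lookup inShape (∈-lookup k) _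

  hook-overlap⇒⊆ : ∀ {c k k'} → c ∈ hook k → c ∈ hook k' → hook k ⊆ hook k'
  hook-overlap⇒⊆ c∈k c∈k' = ⊆-reflexive (cong hook (disjoint _ _ _ c∈k c∈k'))

  hook-continues : ∀ k {i j} → (i , suc j) ∈ hook k → 1 ≤ j →
                   (suc i , suc j) ∈ hook k ⊎ (i , j) ∈ hook k
  hook-continues k = specialRimHook-continues (hook-isRimHook k) (All.lookup special (∈-lookup k))

  initial-not-southeast : ∀ {c n} → IsInitialCellOf T c → ¬ IsInitialCellOf T (c ↘ suc n)
  initial-not-southeast {x , a} {n} (kA , A-initial) (kB , B-initial) =
    let k , east∈k , B∈k = east-joins-next n ≤-refl
    in IsInitialCell-noNorth B-initial (hook-overlap⇒⊆ B∈k (proj₁ B-initial) east∈k)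
    where
    diagonalCell eastCell : ℕ → Cell
    diagonalCell t = (t + x , t + a)
    eastCell     t = (t + x , suc (t + a))

    A-positive : (1 , 1) ≼ (x , a)
    A-positive = InDiagram⇒positive {λs} (hook⊆shape kA (proj₁ A-initial))

    east-inDiagram : ∀ {t} → t ≤ n → InDiagram λs (eastCell t)
    east-inDiagram {t} t≤n =
      InDiagram-downClosed pλ (≤-trans (proj₁ A-positive) (m≤n+m x t) , s≤s z≤n)
                              (+-monoˡ-≤ x (m≤n⇒m≤1+n t≤n) , s≤s (+-monoˡ-≤ a t≤n))
                              (hook⊆shape kB (proj₁ B-initial))

    east-joins-next : ∀ t → t ≤ n → ∃[ k ] (eastCell t ∈ hook k × diagonalCell (suc t) ∈ hook k)
    east-not-west : ∀ t → t ≤ n → ∀ {k} → eastCell t ∈ hook k → diagonalCell t ∉ hook k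

    east-joins-next t t≤n =
      let k , east∈k = covers _ (east-inDiagram t≤n)
      in [ (λ south → k , east∈k , south) , (λ west → ⊥-elim (east-not-west t t≤n east∈k west)) ]′
         (hook-continues k east∈k (≤-trans (proj₂ A-positive) (m≤n+m a t)))

    east-not-west zero    _   east∈k A∈k =
      IsInitialCell-noEast A-initial (hook-overlap⇒⊆ A∈k (proj₁ A-initial) east∈k)
    east-not-west (suc u) t≤n {k} east∈k diagonal∈k =
      let k' , east'∈k' , diagonal∈k' = east-joins-next u (≤-trans (n≤1+n u) t≤n)
      in rimHook-noDiagonalPair (hook-isRimHook k)
                                (hook-overlap⇒⊆ diagonal∈k' diagonal∈k east'∈k') east∈k

  initialCells-sameDiagonal-≤⇒≡ : ∀ {c c'} → IsInitialCellOf T c → IsInitialCellOf T c' →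
                                  diagonal c ≡ diagonal c' → row c ≤ row c' → c ≡ c'
  initialCells-sameDiagonal-≤⇒≡ {c} {c'} c-initial c'-initial eq c≤c'
    with sameDiagonal-≤⇒↘ {c} {c'} eq c≤c'
  ... | zero  , refl = refl
  ... | suc n , refl = ⊥-elim (initial-not-southeast c-initial c'-initial)

lemma6p1 : (λs : List ℕ) → IsPartition λs → (T : SpecialRimHookTableau λs)
           → (d : ℤ) → (c c' : Cell)
           → IsInitialCellOf T c → diagonal c ≡ d
           → IsInitialCellOf T c' → diagonal c' ≡ d
           → c ≡ c'
lemma6p1 λs pλ T d c c' c-initial c-on-d c'-initial c'-on-d =
  [ initialCells-sameDiagonal-≤⇒≡ pλ T c-initial c'-initial same
  , (λ c'≤c → sym (initialCells-sameDiagonal-≤⇒≡ pλ T c'-initial c-initial (sym same) c'≤c)) ]′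
  (≤-total (row c) (row c'))
  where
  same : diagonal c ≡ diagonal c'
  same = trans c-on-d (sym c'-on-d)
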